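{- Let $\nu\ge 3$ and let $z\in\mathbb{F}_2^{2\nu-6}$ be arbitrary. Define the vectors of $\mathbb{F}_2^{2\nu}$ (written as columns, with the last $2\nu-6$ coordinates equal to $z$) $v_1=(1,0,1,0,1,0,z)^\top$, $v_2=(1,0,0,1,0,1,z)^\top$, $v_3=(0,1,1,0,0,1,z)^\top$, $v_4=(0,1,0,1,1,0,z)^\top$. Then $S=\{v_1,v_2,v_3,v_4\}$ is a Godsil-McKay switching set of the symplectic graph $Sp(2\nu,2)$.
   Context: For $\nu\ge1$, let $K=I_\nu\otimes(J_2-I_2)$ over $\mathbb{F}_2$. The symplectic graph $Sp(2\nu,2)$ has as vertices the nonzero vectors of $\mathbb{F}_2^{2\nu}$, with $x$ and $y$ adjacent iff $x^\top K y=1$, i.e. iff $(x_1y_2+x_2y_1)+(x_3y_4+x_4y_3)+\cdots+(x_{2\nu-1}y_{2\nu}+x_{2\nu}y_{2\nu-1})=1$ in $\mathbb{F}_2$. A Godsil-McKay switching set of a graph $G$ is a subset $S$ of the vertex set such that $S$ induces a regular subgraph and every vertex outside $S$ is adjacent to exactly $|S|$, $\tfrac12|S|$ or $0$ vertices of $S$. -}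

module Defs where

open import Data.Nat using (ℕ; zero; suc; _+_; _*_)
open import Data.Bool using (Bool; true; false; _∧_; _xor_; if_then_else_)
open import Data.Vec using (Vec; []; _∷_; replicate)
open import Data.List using (List; length; filter)
open import Data.List.Membership.Propositional using (_∈_; _∉_)
open import Data.List.Relation.Unary.Unique.Propositional using (Unique)
open import Data.Product using (Σ; ∃; _×_)
open import Data.Sum using (_⊎_)
open import Relation.Binary.PropositionalEquality using (_≡_)
open import Relation.Nullary using (¬_)
open import Data.Bool.Properties using (T?)

-- Vectors of F₂^{2ν} are  Vec Bool (ν * 2)  (Bool = F₂, xor = +, ∧ = ·).
-- Symplectic form  x^T K y  with  K = I_ν ⊗ (J₂ - I₂):
--   (x₁y₂ + x₂y₁) + (x₃y₄ + x₄y₃) + ... (computed pairwise).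
sympForm : (ν : ℕ) → Vec Bool (ν * 2) → Vec Bool (ν * 2) → Bool
sympForm zero [] [] = false
sympForm (suc ν) (x₁ ∷ x₂ ∷ x) (y₁ ∷ y₂ ∷ y) =
  ((x₁ ∧ y₂) xor (x₂ ∧ y₁)) xor sympForm ν x y

SpVertex : (ν : ℕ) → Vec Bool (ν * 2) → Set
SpVertex ν x = ¬ (x ≡ replicate (ν * 2) false)

SpAdj : (ν : ℕ) → Vec Bool (ν * 2) → Vec Bool (ν * 2) → Bool
SpAdj ν x y = sympForm ν x y

nbrsIn : {V : Set} → (V → V → Bool) → V → List V → ℕ
nbrsIn adj x S = length (filter (λ s → T? (adj x s)) S)

IsGMSwitchingSet : {V : Set} → (V → Set) → (V → V → Bool) → List V → Set
IsGMSwitchingSet {V} isV adj S =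
  Unique S
  × (∀ {s} → s ∈ S → isV s)
  × (Σ ℕ λ k → ∀ {s} → s ∈ S → nbrsIn adj s S ≡ k)
  × (∀ (x : V) → isV x → x ∉ S →
       (nbrsIn adj x S ≡ length S)
       ⊎ (2 * nbrsIn adj x S ≡ length S)
       ⊎ (nbrsIn adj x S ≡ 0))

module Submission where

-- The four vectors v₁,…,v₄ share the tail z and their 6-entry heads
-- h₁,…,h₄ are pairwise orthogonal with h₁ + h₂ = h₃ + h₄.  Two facts about
-- the symplectic form B(x,y) = x^T K y drive the proof:
--   * B is additive in its second argument, so for every vertex x
--     B(x,v₁) + B(x,v₂) = B(x,v₁+v₂) = B(x,v₃+v₄) = B(x,v₃) + B(x,v₄);
--     hence an even number of the four values B(x,vᵢ) equal 1, i.e. x has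
--     0, 2 or 4 neighbours in S;
--   * B is an orthogonal sum over blocks of coordinates and is alternating
--     (B(z,z) = 0), so B(hᵢ ++ z, hⱼ ++ z) = B(hᵢ,hⱼ) = 0: S is independent,
--     hence induces a 0-regular subgraph.

open import Defs
open import Data.Nat using (ℕ; zero; suc; _+_; _*_)
open import Data.Bool using (Bool; true; false; _xor_; _∧_)
open import Data.Bool.Properties using (xor-assoc; ∧-distribˡ-xor; xor-∧-commutativeRing)
open import Data.Vec using (Vec; []; _∷_; zipWith)
open import Data.List using (List; []; _∷_; map)
open import Data.List.Membership.Propositional using (_∈_; _∉_)
open import Data.List.Relation.Unary.Any using (here; there)
open import Data.List.Relation.Unary.All as All using (All; []; _∷_)
open import Data.List.Relation.Unary.All.Properties using (map⁺)
open import Data.List.Relation.Unary.AllPairs using ([]; _∷_)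
open import Data.List.Relation.Unary.Unique.Propositional using (Unique)
open import Data.Product using (_,_)
open import Data.Sum using (_⊎_; inj₁; inj₂)
open import Relation.Binary.PropositionalEquality using (_≡_; refl; cong; cong₂; trans; module ≡-Reasoning)
open import Algebra.Bundles using (CommutativeRing)
open import Algebra.Properties.CommutativeSemigroup
  (CommutativeRing.+-commutativeSemigroup xor-∧-commutativeRing) using (interchange)

open ≡-Reasoning

bit : Bool → ℕ
bit true  = 1
bit false = 0

nbrsIn-∷ : {V : Set} (adj : V → V → Bool) (x s : V) (S : List V) →
  nbrsIn adj x (s ∷ S) ≡ bit (adj x s) + nbrsIn adj x S
nbrsIn-∷ adj x s S with adj x s
... | true  = refl
... | false = refl

nbrsIn-none : {V : Set} (adj : V → V → Bool) (x : V) {S : List V} →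
  All (λ t → adj x t ≡ false) S → nbrsIn adj x S ≡ 0
nbrsIn-none adj x []                 = refl
nbrsIn-none adj x {s ∷ S} (e ∷ es) =
  trans (nbrsIn-∷ adj x s S) (cong₂ _+_ (cong bit e) (nbrsIn-none adj x es))

AllHalfOrNone : ℕ → ℕ → Set
AllHalfOrNone n k = (n ≡ k) ⊎ (2 * n ≡ k) ⊎ (n ≡ 0)

-- If a + b = c + d in F₂, then an even number of a, b, c, d are 1,
-- so the number of ones is 4, 2 or 0.
evenOfFour : (a b c d : Bool) → a xor b ≡ c xor d →
  AllHalfOrNone (bit a + (bit b + (bit c + (bit d + 0)))) 4
evenOfFour true  true  true  true  _  = inj₁ refl
evenOfFour true  true  true  false ()
evenOfFour true  true  false true  ()
evenOfFour true  true  false false _  = inj₂ (inj₁ refl)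
evenOfFour true  false true  true  ()
evenOfFour true  false true  false _  = inj₂ (inj₁ refl)
evenOfFour true  false false true  _  = inj₂ (inj₁ refl)
evenOfFour true  false false false ()
evenOfFour false true  true  true  ()
evenOfFour false true  true  false _  = inj₂ (inj₁ refl)
evenOfFour false true  false true  _  = inj₂ (inj₁ refl)
evenOfFour false true  false false ()
evenOfFour false false true  true  _  = inj₂ (inj₁ refl)
evenOfFour false false true  false ()
evenOfFour false false false true  ()
evenOfFour false false false false _  = inj₂ (inj₂ refl)

_⊕_ : {n : ℕ} → Vec Bool n → Vec Bool n → Vec Bool n
_⊕_ = zipWith _xor_

sympForm-linearʳ : (ν : ℕ) (x y y′ : Vec Bool (ν * 2)) →
  sympForm ν x (y ⊕ y′) ≡ sympForm ν x y xor sympForm ν x y′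
sympForm-linearʳ zero    []             []             []               = refl
sympForm-linearʳ (suc ν) (x₁ ∷ x₂ ∷ x) (y₁ ∷ y₂ ∷ y) (y₁′ ∷ y₂′ ∷ y′) = begin
  ((x₁ ∧ (y₂ xor y₂′)) xor (x₂ ∧ (y₁ xor y₁′))) xor sympForm ν x (y ⊕ y′)
    ≡⟨ cong₂ _xor_ (cong₂ _xor_ (∧-distribˡ-xor x₁ y₂ y₂′) (∧-distribˡ-xor x₂ y₁ y₁′))
                   (sympForm-linearʳ ν x y y′) ⟩
  (((x₁ ∧ y₂) xor (x₁ ∧ y₂′)) xor ((x₂ ∧ y₁) xor (x₂ ∧ y₁′))) xor (B xor B′)
    ≡⟨ cong (_xor (B xor B′)) (interchange (x₁ ∧ y₂) (x₁ ∧ y₂′) (x₂ ∧ y₁) (x₂ ∧ y₁′)) ⟩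
  (p xor p′) xor (B xor B′)
    ≡⟨ interchange p p′ B B′ ⟩
  (p xor B) xor (p′ xor B′) ∎
  where
  p  = (x₁ ∧ y₂)  xor (x₂ ∧ y₁)
  p′ = (x₁ ∧ y₂′) xor (x₂ ∧ y₁′)
  B  = sympForm ν x y
  B′ = sympForm ν x y′

sympForm-alternating : (ν : ℕ) (z : Vec Bool (ν * 2)) → sympForm ν z z ≡ false
sympForm-alternating zero    []                = refl
sympForm-alternating (suc ν) (true  ∷ true  ∷ z) = sympForm-alternating ν z
sympForm-alternating (suc ν) (true  ∷ false ∷ z) = sympForm-alternating ν z
sympForm-alternating (suc ν) (false ∷ true  ∷ z) = sympForm-alternating ν z
sympForm-alternating (suc ν) (false ∷ false ∷ z) = sympForm-alternating ν z

append₂ : (k m : ℕ) → Vec Bool (k * 2) → Vec Bool (m * 2) → Vec Bool ((k + m) * 2)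
append₂ zero    m []            y = y
append₂ (suc k) m (x₁ ∷ x₂ ∷ x) y = x₁ ∷ x₂ ∷ append₂ k m x y

sympForm-append₂ : (k m : ℕ) (a b : Vec Bool (k * 2)) (x y : Vec Bool (m * 2)) →
  sympForm (k + m) (append₂ k m a x) (append₂ k m b y) ≡ sympForm k a b xor sympForm m x y
sympForm-append₂ zero    m []             []             x y = refl
sympForm-append₂ (suc k) m (a₁ ∷ a₂ ∷ a) (b₁ ∷ b₂ ∷ b) x y = begin
  p xor sympForm (k + m) (append₂ k m a x) (append₂ k m b y)  ≡⟨ cong (p xor_) (sympForm-append₂ k m a b x y) ⟩
  p xor (sympForm k a b xor sympForm m x y)   ≡⟨ xor-assoc p (sympForm k a b) (sympForm m x y) ⟨
  (p xor sympForm k a b) xor sympForm m x y   ∎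
  where p = (a₁ ∧ b₂) xor (a₂ ∧ b₁)

PairwiseOrthogonal : (ν : ℕ) → List (Vec Bool (ν * 2)) → Set
PairwiseOrthogonal ν S = All (λ s → All (λ t → sympForm ν s t ≡ false) S) S

-- Appending a common tail preserves pairwise orthogonality, because the
-- tail is orthogonal to itself.
orthogonal-append₂ : (k m : ℕ) (z : Vec Bool (m * 2)) {H : List (Vec Bool (k * 2))} →
  PairwiseOrthogonal k H → PairwiseOrthogonal (k + m) (map (λ h → append₂ k m h z) H)
orthogonal-append₂ k m z orth = map⁺ (All.map (λ row → map⁺ (All.map extend row)) orth)
  where
  extend : {a b : Vec Bool (k * 2)} → sympForm k a b ≡ false →
    sympForm (k + m) (append₂ k m a z) (append₂ k m b z) ≡ false
  extend {a} {b} e = begin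
    sympForm (k + m) (append₂ k m a z) (append₂ k m b z)   ≡⟨ sympForm-append₂ k m a b z z ⟩
    sympForm k a b xor sympForm m z z      ≡⟨ cong₂ _xor_ e (sympForm-alternating m z) ⟩
    false                                  ∎

switchingCriterion : (ν : ℕ) (v₁ v₂ v₃ v₄ : Vec Bool (ν * 2)) →
  Unique (v₁ ∷ v₂ ∷ v₃ ∷ v₄ ∷ []) →
  (∀ {s} → s ∈ v₁ ∷ v₂ ∷ v₃ ∷ v₄ ∷ [] → SpVertex ν s) →
  PairwiseOrthogonal ν (v₁ ∷ v₂ ∷ v₃ ∷ v₄ ∷ []) →
  v₁ ⊕ v₂ ≡ v₃ ⊕ v₄ →
  IsGMSwitchingSet (SpVertex ν) (SpAdj ν) (v₁ ∷ v₂ ∷ v₃ ∷ v₄ ∷ [])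
switchingCriterion ν v₁ v₂ v₃ v₄ distinct vertices orth sum =
  distinct , vertices , (0 , λ s∈S → nbrsIn-none (SpAdj ν) _ (All.lookup orth s∈S)) , outside
  where
  S : List (Vec Bool (ν * 2))
  S = v₁ ∷ v₂ ∷ v₃ ∷ v₄ ∷ []

  parity : (x : Vec Bool (ν * 2)) →
    sympForm ν x v₁ xor sympForm ν x v₂ ≡ sympForm ν x v₃ xor sympForm ν x v₄
  parity x = begin
    sympForm ν x v₁ xor sympForm ν x v₂  ≡⟨ sympForm-linearʳ ν x v₁ v₂ ⟨
    sympForm ν x (v₁ ⊕ v₂)               ≡⟨ cong (sympForm ν x) sum ⟩
    sympForm ν x (v₃ ⊕ v₄)               ≡⟨ sympForm-linearʳ ν x v₃ v₄ ⟩
    sympForm ν x v₃ xor sympForm ν x v₄  ∎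

  count : (x : Vec Bool (ν * 2)) → nbrsIn (SpAdj ν) x S ≡
    bit (sympForm ν x v₁) + (bit (sympForm ν x v₂) + (bit (sympForm ν x v₃) + (bit (sympForm ν x v₄) + 0)))
  count x = begin
    nbrsIn (SpAdj ν) x S
      ≡⟨ nbrsIn-∷ (SpAdj ν) x v₁ _ ⟩
    bit (sympForm ν x v₁) + nbrsIn (SpAdj ν) x (v₂ ∷ v₃ ∷ v₄ ∷ [])
      ≡⟨ cong (bit (sympForm ν x v₁) +_) (nbrsIn-∷ (SpAdj ν) x v₂ _) ⟩
    bit (sympForm ν x v₁) + (bit (sympForm ν x v₂) + nbrsIn (SpAdj ν) x (v₃ ∷ v₄ ∷ []))
      ≡⟨ cong (λ n → bit (sympForm ν x v₁) + (bit (sympForm ν x v₂) + n))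
              (trans (nbrsIn-∷ (SpAdj ν) x v₃ _)
                     (cong (bit (sympForm ν x v₃) +_) (nbrsIn-∷ (SpAdj ν) x v₄ []))) ⟩
    bit (sympForm ν x v₁) + (bit (sympForm ν x v₂) + (bit (sympForm ν x v₃) + (bit (sympForm ν x v₄) + 0))) ∎

  outside : ∀ x → SpVertex ν x → x ∉ S → AllHalfOrNone (nbrsIn (SpAdj ν) x S) 4
  outside x _ _ rewrite count x =
    evenOfFour (sympForm ν x v₁) (sympForm ν x v₂) (sympForm ν x v₃) (sympForm ν x v₄) (parity x)

heads : List (Vec Bool (3 * 2))
heads = (true  ∷ false ∷ true  ∷ false ∷ true  ∷ false ∷ [])
      ∷ (true  ∷ false ∷ false ∷ true  ∷ false ∷ true  ∷ [])
      ∷ (false ∷ true  ∷ true  ∷ false ∷ false ∷ true  ∷ [])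
      ∷ (false ∷ true  ∷ false ∷ true  ∷ true  ∷ false ∷ [])
      ∷ []

heads-orthogonal : PairwiseOrthogonal 3 heads
heads-orthogonal = (refl ∷ refl ∷ refl ∷ refl ∷ [])
                 ∷ (refl ∷ refl ∷ refl ∷ refl ∷ [])
                 ∷ (refl ∷ refl ∷ refl ∷ refl ∷ [])
                 ∷ (refl ∷ refl ∷ refl ∷ refl ∷ [])
                 ∷ []

proposition2p1 : (m : ℕ) → (z : Vec Bool (m * 2)) →
    IsGMSwitchingSet (SpVertex (3 + m)) (SpAdj (3 + m))
      ( (true ∷ false ∷ true ∷ false ∷ true ∷ false ∷ z)
      ∷ (true ∷ false ∷ false ∷ true ∷ false ∷ true ∷ z)
      ∷ (false ∷ true ∷ true ∷ false ∷ false ∷ true ∷ z)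
      ∷ (false ∷ true ∷ false ∷ true ∷ true ∷ false ∷ z)
      ∷ [] )
proposition2p1 m z =
  switchingCriterion (3 + m) _ _ _ _ distinct nonzero
    (orthogonal-append₂ 3 m z heads-orthogonal) refl
  where
  S : List (Vec Bool ((3 + m) * 2))
  S = map (λ h → append₂ 3 m h z) heads

  distinct : Unique S
  distinct = ((λ ()) ∷ (λ ()) ∷ (λ ()) ∷ []) ∷ ((λ ()) ∷ (λ ()) ∷ []) ∷ ((λ ()) ∷ []) ∷ [] ∷ []

  nonzero : ∀ {s} → s ∈ S → SpVertex (3 + m) s
  nonzero (here refl)                         ()
  nonzero (there (here refl))                 ()
  nonzero (there (there (here refl)))         ()
  nonzero (there (there (there (here refl)))) ()
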